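{- ${\rm fasd}(5,4)<4$, ${\rm fasd}(4,6)<6$, and ${\rm fasd}(3,9)<9$.
   Context: An oriented graph is a digraph without loops, multiple arcs or directed $2$-cycles. Degree = in-degree + out-degree; directed girth = minimum length of a directed cycle ($\infty$ if none). For a digraph $D$, ${\rm fasd}(D)$ is the maximum number $t$ such that $A(D)$ can be partitioned into $t$ feedback arc sets (sets of arcs whose removal makes $D$ acyclic), with ${\rm fasd}(D)=\infty$ if $D$ is acyclic. ${\rm fasd}(\Delta,g)$ is the minimum of ${\rm fasd}(D)$ over all oriented graphs $D$ with maximum degree at most $\Delta$ and directed girth at least $g$. -}

module Defs where

open import Data.Nat using (ℕ; zero; suc; _+_; _≤_; _<_)
open import Data.Fin using (Fin; zero; suc; inject₁; fromℕ)
open import Data.Bool using (Bool; true; false; if_then_else_; _∧_; not)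
open import Data.List using (List; map; allFin)
open import Data.Nat.ListAction using (sum)
open import Data.Product using (Σ; _×_; ∃; ∃-syntax)
open import Relation.Nullary using (¬_)
open import Relation.Binary.PropositionalEquality using (_≡_)
open import Function.Definitions using (Injective)

record Digraph : Set where
  field
    n   : ℕ
    arc : Fin n → Fin n → Bool
open Digraph public

IsOriented : Digraph → Set
IsOriented D = (∀ v → arc D v v ≡ false)
             × (∀ u v → arc D u v ≡ true → arc D v u ≡ false)

-- Directed cycle of length (suc m): distinct vertices c 0, ..., c m
-- with arcs c i → c (i+1) and c m → c 0.
record DirCycle (n : ℕ) (A : Fin n → Fin n → Bool) (m : ℕ) : Set where
  field
    vtx      : Fin (suc m) → Fin n
    distinct : Injective _≡_ _≡_ vtx
    step     : ∀ (i : Fin m) → A (vtx (inject₁ i)) (vtx (suc i)) ≡ true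
    close    : A (vtx (fromℕ m)) (vtx zero) ≡ true

AcyclicRel : (n : ℕ) → (Fin n → Fin n → Bool) → Set
AcyclicRel n A = ∀ m → ¬ DirCycle n A m

Acyclic : Digraph → Set
Acyclic D = AcyclicRel (n D) (arc D)

GirthAtLeast : Digraph → ℕ → Set
GirthAtLeast D g = ∀ m → DirCycle (n D) (arc D) m → g ≤ suc m

indicator : Bool → ℕ
indicator b = if b then 1 else 0

outdeg : (D : Digraph) → Fin (n D) → ℕ
outdeg D v = sum (map (λ w → indicator (arc D v w)) (allFin (n D)))

indeg : (D : Digraph) → Fin (n D) → ℕ
indeg D v = sum (map (λ w → indicator (arc D w v)) (allFin (n D)))

degree : (D : Digraph) → Fin (n D) → ℕ
degree D v = indeg D v + outdeg D v

MaxDegreeAtMost : Digraph → ℕ → Set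
MaxDegreeAtMost D Δ = ∀ v → degree D v ≤ Δ

-- A set S of arcs (given as a Boolean predicate on vertex pairs, only
-- meaningful on arcs) is a feedback arc set if D minus S is acyclic.
removeArcs : (D : Digraph) → (Fin (n D) → Fin (n D) → Bool) → Fin (n D) → Fin (n D) → Bool
removeArcs D S u v = arc D u v ∧ not (S u v)

IsFAS : (D : Digraph) → (Fin (n D) → Fin (n D) → Bool) → Set
IsFAS D S = AcyclicRel (n D) (removeArcs D S)

-- Partition of A(D) into t feedback arc sets: each arc gets a part index
-- c u v : Fin t; part i = arcs with index i; every part is a FAS.
_≟F_ : ∀ {t} → Fin t → Fin t → Bool
zero  ≟F zero  = true
zero  ≟F suc _ = false
suc _ ≟F zero  = false
suc i ≟F suc j = i ≟F j

part : (D : Digraph) {t : ℕ} → (Fin (n D) → Fin (n D) → Fin t) → Fin t → Fin (n D) → Fin (n D) → Bool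
part D c i u v = arc D u v ∧ (c u v ≟F i)

HasFASPartition : Digraph → ℕ → Set
HasFASPartition D t = Σ (Fin (n D) → Fin (n D) → Fin t) λ c → ∀ i → IsFAS D (part D c i)

-- fasd(D) < k  (fasd(D) = ∞ if D is acyclic, else max t with a partition into t FAS).
FasdLt : Digraph → ℕ → Set
FasdLt D k = ¬ Acyclic D × (∀ t → k ≤ t → ¬ HasFASPartition D t)

-- fasd(Δ,g) < k : the minimum over oriented graphs of max degree ≤ Δ and
-- directed girth ≥ g is < k, i.e. some such oriented graph has fasd < k.
FasdΔgLt : ℕ → ℕ → ℕ → Set
FasdΔgLt Δ g k = ∃[ D ] (IsOriented D × MaxDegreeAtMost D Δ × GirthAtLeast D g × FasdLt D k)

module Submission where

-- If A(D) is split into t feedback arc sets, every directed cycle meets all t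
-- parts, for otherwise it survives the deletion of the part it misses. So t is
-- at most the length g of a shortest cycle, and when t = g every g-cycle is
-- rainbow: distinct arcs on a common g-cycle lie in distinct parts. Hence
-- fasd(D) < g as soon as the arcs of D admit no g-colouring in which arcs
-- sharing a g-cycle get distinct colours. For each bound we give an oriented
-- graph of the required degree and girth and rule such colourings out by an
-- exhaustive search, after fixing (up to a permutation of the colours) the
-- colours along one g-cycle.

open import Defs
open import Data.Bool.Base using (Bool; true; false; T; not; _∧_)
open import Data.Bool.Properties using (T-∧; T-≡) renaming (_≟_ to _≟ᵇ_)
open import Data.Fin using (Fin; zero; suc; inject₁; fromℕ; toℕ; punchOut; #_)
open import Data.Fin.Properties using (_≟_; any?; all?; injective⇒≤; punchOut-injective; toℕ-fromℕ; toℕ-inject₁)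
open import Data.Fin.Relation.Unary.Top using (view; ‵fromℕ; ‵inject₁; view-fromℕ; view-inject₁)
open import Data.Bool.ListAction using (any; all)
open import Data.List.Base using (List; []; _∷_; map; tabulate; allFin)
open import Data.List.Membership.Propositional using (_∈_; lose)
open import Data.List.Membership.Propositional.Properties using (∈-tabulate⁺; ∈-tabulate⁻; ∈-allFin)
open import Data.List.Properties using (map-∘; map-cong)
import Data.List.Relation.Unary.Any as Any
open import Data.List.Relation.Unary.Any.Properties using (any⁺)
open import Data.Nat.Base using (ℕ; zero; suc; _≤_; _<_; _≡ᵇ_; s≤s)
open import Data.Nat.Properties using (suc-injective; ≤-refl; ≤-antisym; <⇒≱; ≰⇒>; allUpTo?) renaming (_≤?_ to _≤ℕ?_)
open import Data.Product using (_×_; _,_; proj₁; proj₂; ∃)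
open import Data.Product.Properties using (≡-dec)
open import Data.Unit using (tt)
open import Data.Vec.Base using (Vec; []; _∷_; lookup) renaming (tabulate to tabulateᵛ)
open import Data.Vec.Properties using (lookup∘tabulate)
open import Function.Base using (_∘_)
open import Function.Bundles using (Equivalence)
open import Function.Definitions using (Injective; StrictlySurjective)
open import Relation.Binary.Definitions using (Decidable; DecidableEquality)
open import Relation.Binary.PropositionalEquality using (_≡_; _≢_; refl; sym; trans; cong; subst)
open import Relation.Nullary using (¬_; Dec; yes; no; does; contradiction)
open import Relation.Nullary.Decidable using (True; toWitness; from-yes; dec-true; ¬?; _×-dec_; _→-dec_; T?)

injective⇒surjective : ∀ {m n} {f : Fin m → Fin n} → n ≤ m → Injective _≡_ _≡_ f → StrictlySurjective _≡_ f
injective⇒surjective {n = suc n} {f} n<m f-injective y with any? (λ x → f x ≟ y)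
... | yes hit  = hit
... | no  miss = contradiction (injective⇒≤ avoid-injective) (<⇒≱ n<m)
  where
  y≢f : ∀ x → y ≢ f x
  y≢f x y≡fx = miss (x , sym y≡fx)
  avoid-injective : Injective _≡_ _≡_ (λ x → punchOut (y≢f x))
  avoid-injective {x} {x′} = f-injective ∘ punchOut-injective (y≢f x) (y≢f x′)

module _ {m n} {f : Fin m → Fin n} (f-surjective : StrictlySurjective _≡_ f) where

  private
    section : Fin n → Fin m
    section y = proj₁ (f-surjective y)

    section-inverse : ∀ y → f (section y) ≡ y
    section-inverse y = proj₂ (f-surjective y)

    section-injective : Injective _≡_ _≡_ section
    section-injective {y} {y′} e =
      trans (sym (section-inverse y)) (trans (cong f e) (section-inverse y′))

  surjective⇒≥ : n ≤ m
  surjective⇒≥ = injective⇒≤ section-injective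

  surjective⇒injective : m ≤ n → Injective _≡_ _≡_ f
  surjective⇒injective m≤n {x} {x′} fx≡fx′
    with y , refl ← injective⇒surjective m≤n section-injective x
       | y′ , refl ← injective⇒surjective m≤n section-injective x′
    = cong section (trans (sym (section-inverse y)) (trans fx≡fx′ (section-inverse y′)))

T-∧-intro : ∀ {x y} → T x → T y → T (x ∧ y)
T-∧-intro tx ty = Equivalence.from T-∧ (tx , ty)

≟F-≢ : ∀ {t} {i j : Fin t} → i ≢ j → (i ≟F j) ≡ false
≟F-≢ {i = zero}  {zero}  i≢j = contradiction refl i≢j
≟F-≢ {i = zero}  {suc j} _   = refl
≟F-≢ {i = suc i} {zero}  _   = refl
≟F-≢ {i = suc i} {suc j} i≢j = ≟F-≢ (i≢j ∘ cong suc)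

Arc : ℕ → Set
Arc n = Fin n × Fin n

next : ∀ {m} → Fin (suc m) → Fin (suc m)
next i with view i
... | ‵fromℕ     = zero
... | ‵inject₁ j = suc j

next-fromℕ : ∀ m → next (fromℕ m) ≡ zero
next-fromℕ m rewrite view-fromℕ m = refl

next-inject₁ : ∀ {m} (j : Fin m) → next (inject₁ j) ≡ suc j
next-inject₁ j rewrite view-inject₁ j = refl

module _ {n m} {A : Fin n → Fin n → Bool} (C : DirCycle n A m) where
  open DirCycle C

  arcAt : Fin (suc m) → Arc n
  arcAt i = vtx i , vtx (next i)

  arcAt-injective : Injective _≡_ _≡_ arcAt
  arcAt-injective = distinct ∘ cong proj₁

  cycleArcs : List (Arc n)
  cycleArcs = tabulate arcAt

module _ {n m K} {A : Fin n → Fin n → Bool} (cycles : Fin K → DirCycle n A m) where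

  OnCommonCycle : Arc n → Arc n → Set
  OnCommonCycle a b = a ≢ b × ∃ λ j → a ∈ cycleArcs (cycles j) × b ∈ cycleArcs (cycles j)

  onCommonCycle? : Decidable OnCommonCycle
  onCommonCycle? a b =
    ¬? (a ≟ₐ b)
    ×-dec any? (λ j → Any.any? (a ≟ₐ_) (cycleArcs (cycles j)) ×-dec Any.any? (b ≟ₐ_) (cycleArcs (cycles j)))
    where
    _≟ₐ_ : DecidableEquality (Arc n)
    _≟ₐ_ = ≡-dec _≟_ _≟_

  arcAt-onCommonCycle : ∀ j {i i′} → i ≢ i′ → OnCommonCycle (arcAt (cycles j) i) (arcAt (cycles j) i′)
  arcAt-onCommonCycle j {i} {i′} i≢i′ =
    i≢i′ ∘ arcAt-injective (cycles j) , j , ∈-tabulate⁺ {f = arcAt (cycles j)} i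
                                          , ∈-tabulate⁺ {f = arcAt (cycles j)} i′

module FASPartition (D : Digraph) {t} (c : Fin (n D) → Fin (n D) → Fin t)
                    (fas : ∀ k → IsFAS D (part D c k)) where

  colour : Arc (n D) → Fin t
  colour (u , v) = c u v

  survives-removal : ∀ {u v} k → arc D u v ≡ true → c u v ≢ k → removeArcs D (part D c k) u v ≡ true
  survives-removal k uv c≢k rewrite uv | ≟F-≢ c≢k = refl

  module _ {m} (C : DirCycle (n D) (arc D) m) where
    open DirCycle C

    cycle-meets-every-part : StrictlySurjective _≡_ (colour ∘ arcAt C)
    cycle-meets-every-part k with any? (λ i → colour (arcAt C i) ≟ k)
    ... | yes hit = hit
    ... | no miss = contradiction survivor (fas k m)
      where
      avoids : ∀ i {w} → next i ≡ w → c (vtx i) (vtx w) ≢ k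
      avoids i refl e = miss (i , e)
      survivor : DirCycle (n D) (removeArcs D (part D c k)) m
      survivor = record
        { vtx      = vtx
        ; distinct = distinct
        ; step     = λ j → survives-removal k (step j) (avoids (inject₁ j) (next-inject₁ j))
        ; close    = survives-removal k close (avoids (fromℕ m) (next-fromℕ m))
        }

    partition-size≤length : t ≤ suc m
    partition-size≤length = surjective⇒≥ cycle-meets-every-part

    rainbow : suc m ≤ t → Injective _≡_ _≡_ (colour ∘ arcAt C)
    rainbow = surjective⇒injective cycle-meets-every-part

  module _ {m K} (cycles : Fin K → DirCycle (n D) (arc D) m) (m<t : suc m ≤ t) where

    onCommonCycle⇒distinct-colours : ∀ {a b} → OnCommonCycle cycles a b → colour a ≢ colour b
    onCommonCycle⇒distinct-colours (a≢b , j , a∈ , b∈) ca≡cb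
      with i , refl ← ∈-tabulate⁻ {f = arcAt (cycles j)} a∈
         | i′ , refl ← ∈-tabulate⁻ {f = arcAt (cycles j)} b∈
      = a≢b (cong (arcAt (cycles j)) (rainbow (cycles j) m<t ca≡cb))

module Colouring {V : Set} {R : V → V → Set} (R? : Decidable R) {t : ℕ} where

  Proper : (V → Fin t) → Set
  Proper κ = ∀ {a b} → R a b → κ a ≢ κ b

  IsClique : (Fin t → V) → Set
  IsClique K = ∀ {i j} → i ≢ j → R (K i) (K j)

  fits : List (V × Fin t) → V → Fin t → Bool
  fits done a k = all (λ (b , l) → not (does (l ≟ k) ∧ does (R? b a))) done

  extendable : List (V × Fin t) → List V → Bool
  extendable done []         = true
  extendable done (a ∷ todo) = any (λ k → fits done a k ∧ extendable ((a , k) ∷ done) todo) (allFin t)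

  private
    no-clash : ∀ {P Q : Set} (p? : Dec P) (q? : Dec Q) → (P → ¬ Q) → T (not (does p? ∧ does q?))
    no-clash (no _)  _       _    = tt
    no-clash (yes _) (no _)  _    = tt
    no-clash (yes p) (yes q) p⇒¬q = p⇒¬q p q

  graphOf : (V → Fin t) → List V → List (V × Fin t)
  graphOf κ = map (λ b → b , κ b)

  module _ {κ : V → Fin t} (proper : Proper κ) where

    fits-proper : ∀ bs a → T (fits (graphOf κ bs) a (κ a))
    fits-proper []       a = tt
    fits-proper (b ∷ bs) a =
      T-∧-intro (no-clash (κ b ≟ κ a) (R? b a) (λ κb≡κa r → proper r κb≡κa)) (fits-proper bs a)

    extendable-proper : ∀ bs todo → T (extendable (graphOf κ bs) todo)
    extendable-proper bs []         = tt
    extendable-proper bs (a ∷ todo) =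
      any⁺ (λ k → fits (graphOf κ bs) a k ∧ extendable ((a , k) ∷ graphOf κ bs) todo)
        (lose (∈-allFin (κ a)) (T-∧-intro (fits-proper bs a) (extendable-proper (a ∷ bs) todo)))

  relabel : ∀ {κ} {π : Fin t → Fin t} → Injective _≡_ _≡_ π → Proper κ → Proper (π ∘ κ)
  relabel π-injective proper r = proper r ∘ π-injective

  clique-injective : ∀ {κ K} → Proper κ → IsClique K → Injective _≡_ _≡_ (κ ∘ K)
  clique-injective proper clique {i} {j} κKi≡κKj with i ≟ j
  ... | yes i≡j = i≡j
  ... | no  i≢j = contradiction κKi≡κKj (proper (clique i≢j))

  normalise-on-clique : ∀ {κ K} → Proper κ → IsClique K → ∃ λ κ′ → Proper κ′ × (∀ i → κ′ (K i) ≡ i)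
  normalise-on-clique {κ} {K} proper clique = π ∘ κ , relabel π-injective proper , π-fixes
    where
    κK-injective : Injective _≡_ _≡_ (κ ∘ K)
    κK-injective = clique-injective proper clique
    κK-surjective : StrictlySurjective _≡_ (κ ∘ K)
    κK-surjective = injective⇒surjective ≤-refl κK-injective
    π : Fin t → Fin t
    π k = proj₁ (κK-surjective k)
    π-section : ∀ k → κ (K (π k)) ≡ k
    π-section k = proj₂ (κK-surjective k)
    π-injective : Injective _≡_ _≡_ π
    π-injective {k} {k′} e = trans (sym (π-section k)) (trans (cong (κ ∘ K) e) (π-section k′))
    π-fixes : ∀ i → π (κ (K i)) ≡ i
    π-fixes i = κK-injective (π-section (κ (K i)))

  uncolourable : ∀ {K} → IsClique K → ∀ todo → extendable (map (λ i → K i , i) (allFin t)) todo ≡ false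
               → ∀ κ → ¬ Proper κ
  uncolourable {K} clique todo exhausted κ proper with κ′ , proper′ , fixes ← normalise-on-clique proper clique =
    subst T (trans (cong (λ done → extendable done todo) labelled) exhausted)
      (extendable-proper proper′ (map K (allFin t)) todo)
    where
    labelled : graphOf κ′ (map K (allFin t)) ≡ map (λ i → K i , i) (allFin t)
    labelled = trans (sym (map-∘ (allFin t))) (map-cong (λ i → cong (K i ,_) (fixes i)) (allFin t))

-- todo need not list every arc: it suffices that no colouring of the arcs of
-- cycle z and of todo is proper for OnCommonCycle. Its order steers the search.
fasd<length : (D : Digraph) {m K : ℕ} (cycles : Fin K → DirCycle (n D) (arc D) m)
              (z : Fin K) (todo : List (Arc (n D)))
            → Colouring.extendable (onCommonCycle? cycles)
                (map (λ i → arcAt (cycles z) i , i) (allFin (suc m))) todo ≡ false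
            → FasdLt D (suc m)
fasd<length D {m} cycles z todo exhausted = (λ acyclic → acyclic m (cycles z)) , no-partition
  where
  no-partition : ∀ t → suc m ≤ t → ¬ HasFASPartition D t
  no-partition t m<t (c , fas)
    with refl ← ≤-antisym (FASPartition.partition-size≤length D c fas (cycles z)) m<t =
    uncolourable (arcAt-onCommonCycle cycles z) todo exhausted colour
      (onCommonCycle⇒distinct-colours cycles ≤-refl)
    where
    open FASPartition D c fas
    open Colouring (onCommonCycle? cycles)

isOriented? : (D : Digraph) → Dec (IsOriented D)
isOriented? D =
  all? (λ v → arc D v v ≟ᵇ false)
  ×-dec all? (λ u → all? (λ v → (arc D u v ≟ᵇ true) →-dec (arc D v u ≟ᵇ false)))

maxDegree? : (D : Digraph) (Δ : ℕ) → Dec (MaxDegreeAtMost D Δ)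
maxDegree? D Δ = all? (λ v → degree D v ≤ℕ? Δ)

module _ (D : Digraph) where

  successors : Vec Bool (n D) → Vec Bool (n D)
  successors s = tabulateᵛ (λ w → any (λ u → lookup s u ∧ arc D u w) (allFin (n D)))

  walkEnds : ℕ → Fin (n D) → Vec Bool (n D)
  walkEnds zero    v = tabulateᵛ (λ w → does (v ≟ w))
  walkEnds (suc k) v = successors (walkEnds k v)

  successors-step : ∀ s {u w} → T (lookup s u) → arc D u w ≡ true → T (lookup (successors s) w)
  successors-step s {u} {w} su uw =
    subst T (sym (lookup∘tabulate _ w))
      (any⁺ (λ u′ → lookup s u′ ∧ arc D u′ w)
        (lose (∈-allFin u) (T-∧-intro su (Equivalence.from T-≡ uw))))

  module _ {m} (C : DirCycle (n D) (arc D) m) where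
    open DirCycle C

    walkEnds-cycle : ∀ k (i : Fin (suc m)) → toℕ i ≡ k → T (lookup (walkEnds k (vtx zero)) (vtx i))
    walkEnds-cycle zero    zero    _ =
      subst T (sym (lookup∘tabulate _ (vtx zero))) (Equivalence.from T-≡ (dec-true (vtx zero ≟ vtx zero) refl))
    walkEnds-cycle (suc k) (suc j) j+1≡k+1 =
      successors-step (walkEnds k (vtx zero))
        (walkEnds-cycle k (inject₁ j) (trans (toℕ-inject₁ j) (suc-injective j+1≡k+1))) (step j)

    cycle-closedWalk : T (lookup (walkEnds (suc m) (vtx zero)) (vtx zero))
    cycle-closedWalk =
      successors-step (walkEnds m (vtx zero)) (walkEnds-cycle m (fromℕ m) (toℕ-fromℕ m)) close

  NoShortClosedWalk : ℕ → Set
  NoShortClosedWalk g = ∀ v {k} → k < g → ¬ T (lookup (walkEnds (suc k) v) v)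

  noShortClosedWalk? : ∀ g → Dec (NoShortClosedWalk g)
  noShortClosedWalk? g = all? (λ v → allUpTo? (λ k → ¬? (T? (lookup (walkEnds (suc k) v) v))) g)

  noShortClosedWalk⇒girth : ∀ {g} → NoShortClosedWalk g → GirthAtLeast D (suc g)
  noShortClosedWalk⇒girth {g} noWalk m C with suc g ≤ℕ? suc m
  ... | yes g≤m = g≤m
  ... | no  g≰m with s≤s m<g ← ≰⇒> g≰m =
    contradiction (cycle-closedWalk C) (noWalk (DirCycle.vtx C zero) m<g)

fromArcList : ℕ → List (ℕ × ℕ) → Digraph
fromArcList N arcs = record
  { n   = N
  ; arc = λ u v → any (λ (a , b) → (toℕ u ≡ᵇ a) ∧ (toℕ v ≡ᵇ b)) arcs
  }

module _ {N : ℕ} {A : Fin N → Fin N → Bool} where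

  IsClosedPath : ∀ {m} → Vec (Fin N) (suc m) → Set
  IsClosedPath {m} vs = (∀ i j → lookup vs i ≡ lookup vs j → i ≡ j)
                      × (∀ i → A (lookup vs (inject₁ i)) (lookup vs (suc i)) ≡ true)
                      × A (lookup vs (fromℕ m)) (lookup vs zero) ≡ true

  isClosedPath? : ∀ {m} (vs : Vec (Fin N) (suc m)) → Dec (IsClosedPath vs)
  isClosedPath? vs =
    all? (λ i → all? (λ j → (lookup vs i ≟ lookup vs j) →-dec (i ≟ j)))
    ×-dec all? (λ i → A (lookup vs (inject₁ i)) (lookup vs (suc i)) ≟ᵇ true)
    ×-dec (A (lookup vs (fromℕ _)) (lookup vs zero) ≟ᵇ true)

  cycleThrough : ∀ {m} (vs : Vec (Fin N) (suc m)) → {True (isClosedPath? vs)} → DirCycle N A m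
  cycleThrough vs {closed} = record
    { vtx      = lookup vs
    ; distinct = λ {i} {j} → proj₁ path i j
    ; step     = proj₁ (proj₂ path)
    ; close    = proj₂ (proj₂ path)
    }
    where
    path : IsClosedPath vs
    path = toWitness closed

module Fasd[5,4] where

  D : Digraph
  D = fromArcList 8 ((0 , 4) ∷ (0 , 7) ∷ (1 , 5) ∷ (2 , 4) ∷ (2 , 6) ∷ (3 , 6) ∷ (3 , 7) ∷ (4 , 1) ∷ (4 , 3) ∷ (5 , 0) ∷ (5 , 2) ∷ (5 , 3) ∷ (6 , 0) ∷ (6 , 1) ∷ (7 , 1) ∷ (7 , 2) ∷ [])

  cycles : Fin 9 → DirCycle 8 (arc D) 3
  cycles = lookup
    ( cycleThrough (# 0 ∷ # 4 ∷ # 1 ∷ # 5 ∷ [])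
    ∷ cycleThrough (# 0 ∷ # 4 ∷ # 3 ∷ # 6 ∷ [])
    ∷ cycleThrough (# 0 ∷ # 7 ∷ # 1 ∷ # 5 ∷ [])
    ∷ cycleThrough (# 0 ∷ # 7 ∷ # 2 ∷ # 6 ∷ [])
    ∷ cycleThrough (# 1 ∷ # 5 ∷ # 2 ∷ # 4 ∷ [])
    ∷ cycleThrough (# 1 ∷ # 5 ∷ # 2 ∷ # 6 ∷ [])
    ∷ cycleThrough (# 1 ∷ # 5 ∷ # 3 ∷ # 6 ∷ [])
    ∷ cycleThrough (# 1 ∷ # 5 ∷ # 3 ∷ # 7 ∷ [])
    ∷ cycleThrough (# 2 ∷ # 4 ∷ # 3 ∷ # 7 ∷ [])
    ∷ [])

  fasd<4 : FasdΔgLt 5 4 4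
  fasd<4 = D , from-yes (isOriented? D) , from-yes (maxDegree? D 5)
         , noShortClosedWalk⇒girth D (from-yes (noShortClosedWalk? D 3))
         , fasd<length D cycles (# 1)
             ((# 7 , # 2) ∷ (# 2 , # 6) ∷ (# 0 , # 7) ∷ (# 1 , # 5) ∷ (# 3 , # 7) ∷ (# 2 , # 4) ∷ (# 4 , # 1) ∷ (# 5 , # 0) ∷ (# 7 , # 1) ∷ (# 5 , # 3) ∷ (# 6 , # 1) ∷ (# 5 , # 2) ∷ [])
             refl

module Fasd[4,6] where

  D : Digraph
  D = fromArcList 15 ((0 , 4) ∷ (0 , 7) ∷ (1 , 8) ∷ (8 , 5) ∷ (2 , 4) ∷ (2 , 6) ∷ (3 , 6) ∷ (3 , 7) ∷ (4 , 9) ∷ (9 , 1) ∷ (4 , 10) ∷ (10 , 3) ∷ (5 , 0) ∷ (5 , 2) ∷ (5 , 3) ∷ (6 , 11) ∷ (11 , 0) ∷ (6 , 12) ∷ (12 , 1) ∷ (7 , 13) ∷ (13 , 1) ∷ (7 , 14) ∷ (14 , 2) ∷ [])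

  cycles : Fin 9 → DirCycle 15 (arc D) 5
  cycles = lookup
    ( cycleThrough (# 0 ∷ # 4 ∷ # 10 ∷ # 3 ∷ # 6 ∷ # 11 ∷ [])
    ∷ cycleThrough (# 2 ∷ # 4 ∷ # 10 ∷ # 3 ∷ # 7 ∷ # 14 ∷ [])
    ∷ cycleThrough (# 0 ∷ # 7 ∷ # 14 ∷ # 2 ∷ # 6 ∷ # 11 ∷ [])
    ∷ cycleThrough (# 0 ∷ # 4 ∷ # 9 ∷ # 1 ∷ # 8 ∷ # 5 ∷ [])
    ∷ cycleThrough (# 1 ∷ # 8 ∷ # 5 ∷ # 3 ∷ # 6 ∷ # 12 ∷ [])
    ∷ cycleThrough (# 0 ∷ # 7 ∷ # 13 ∷ # 1 ∷ # 8 ∷ # 5 ∷ [])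
    ∷ cycleThrough (# 1 ∷ # 8 ∷ # 5 ∷ # 2 ∷ # 6 ∷ # 12 ∷ [])
    ∷ cycleThrough (# 1 ∷ # 8 ∷ # 5 ∷ # 3 ∷ # 7 ∷ # 13 ∷ [])
    ∷ cycleThrough (# 1 ∷ # 8 ∷ # 5 ∷ # 2 ∷ # 4 ∷ # 9 ∷ [])
    ∷ [])

  fasd<6 : FasdΔgLt 4 6 6
  fasd<6 = D , from-yes (isOriented? D) , from-yes (maxDegree? D 4)
         , noShortClosedWalk⇒girth D (from-yes (noShortClosedWalk? D 5))
         , fasd<length D cycles (# 0)
             ((# 14 , # 2) ∷ (# 7 , # 14) ∷ (# 0 , # 7) ∷ (# 2 , # 6) ∷ (# 1 , # 8) ∷ (# 3 , # 7) ∷ (# 2 , # 4) ∷ (# 8 , # 5) ∷ (# 4 , # 9) ∷ (# 5 , # 2) ∷ (# 9 , # 1) ∷ (# 5 , # 0) ∷ (# 6 , # 12) ∷ (# 12 , # 1) ∷ (# 5 , # 3) ∷ (# 7 , # 13) ∷ (# 13 , # 1) ∷ [])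
             refl

-- The ten arcs of the paths 0→6→7→5, 1→8→9→4 and 2→11→12→13→3 pairwise share
-- one of the three 9-cycles, so they would need ten distinct colours.
module Fasd[3,9] where

  D : Digraph
  D = fromArcList 14 ((3 , 0) ∷ (4 , 0) ∷ (0 , 6) ∷ (6 , 7) ∷ (7 , 5) ∷ (3 , 1) ∷ (1 , 8) ∷ (8 , 9) ∷ (9 , 4) ∷ (5 , 10) ∷ (10 , 1) ∷ (2 , 11) ∷ (11 , 12) ∷ (12 , 13) ∷ (13 , 3) ∷ (4 , 2) ∷ (5 , 2) ∷ [])

  cycles : Fin 3 → DirCycle 14 (arc D) 8
  cycles = lookup
    ( cycleThrough (# 0 ∷ # 6 ∷ # 7 ∷ # 5 ∷ # 10 ∷ # 1 ∷ # 8 ∷ # 9 ∷ # 4 ∷ [])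
    ∷ cycleThrough (# 0 ∷ # 6 ∷ # 7 ∷ # 5 ∷ # 2 ∷ # 11 ∷ # 12 ∷ # 13 ∷ # 3 ∷ [])
    ∷ cycleThrough (# 1 ∷ # 8 ∷ # 9 ∷ # 4 ∷ # 2 ∷ # 11 ∷ # 12 ∷ # 13 ∷ # 3 ∷ [])
    ∷ [])

  fasd<9 : FasdΔgLt 3 9 9
  fasd<9 = D , from-yes (isOriented? D) , from-yes (maxDegree? D 3)
         , noShortClosedWalk⇒girth D (from-yes (noShortClosedWalk? D 8))
         , fasd<length D cycles (# 1) ((# 1 , # 8) ∷ (# 8 , # 9) ∷ (# 9 , # 4) ∷ []) refl

theorem9 : FasdΔgLt 5 4 4 × FasdΔgLt 4 6 6 × FasdΔgLt 3 9 9
theorem9 = Fasd[5,4].fasd<4 , Fasd[4,6].fasd<6 , Fasd[3,9].fasd<9
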